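{- Let $F=\coprod_{i\in I}\hom(X_i,-):\mathbf{Set}\to\mathbf{Set}$ for a non-empty family of sets $(X_i)_{i\in I}$, and let $\alpha^s:F\times F\to F$ be the natural transformation corresponding to an element $s=(s_{ij})_{i,j\in I}\in\prod_{i,j\in I}F(X_i+X_j)$. Then $\alpha^s$ is commutative if and only if for all $i,j\in I$, \[ F[i_2,i_1](s_{ij})=s_{ji}, \] i.e. if $s_{ij}$ is the map $X_k\to X_i+X_j$ in the $k$-th summand, then $s_{ji}$ is the map $[i_2,i_1]\circ s_{ij}:X_k\to X_j+X_i$ in the same summand, where $i_1:X_j\to X_j+X_i$, $i_2:X_i\to X_j+X_i$ are the coproduct injections. In particular, if $\alpha^s$ is commutative then for every $i\in I$, $s_{ii}$ is a map with empty domain.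
   Context: An element $s_{ij}\in F(X_i+X_j)$ is a pair consisting of an index $k\in I$ and a map $X_k\to X_i+X_j$. The natural transformation $\alpha^s$ associated with $s$ is defined at each set $Y$ by $\alpha^s_Y(a,b)=F[a,b](s_{ij})$ for $(a,b)\in\hom(X_i,Y)\times\hom(X_j,Y)$, where $[a,b]:X_i+X_j\to Y$ is the copairing; every natural transformation $F\times F\to F$ is of this form for a unique $s$. A natural transformation $\alpha:F\times F\to F$ is commutative if for every set $X$ and all maps $a,b:X\to FX$, $\alpha_X\circ\langle a,b\rangle=\alpha_X\circ\langle b,a\rangle$. -}

module Defs where

open import Data.Product using (Σ; _,_; proj₁; proj₂)
open import Data.Sum using (_⊎_; inj₁; inj₂; [_,_])
open import Relation.Binary.PropositionalEquality using (_≡_; subst)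
open import Function using (_∘_)

F : (I : Set) (X : I → Set) → Set → Set
F I X Y = Σ I (λ i → X i → Y)

Fmap : (I : Set) (X : I → Set) {Y Z : Set} → (Y → Z) → F I X Y → F I X Z
Fmap I X g (k , f) = (k , g ∘ f)

-- This is the standard
-- (extensional) equality of hom-sets, since Agda has no function
-- extensionality.

FEq : (I : Set) (X : I → Set) {Y : Set} → F I X Y → F I X Y → Set
FEq I X (k , f) (k' , f') = Σ (k ≡ k') (λ p → ∀ x → f x ≡ f' (subst X p x))

Family : (I : Set) (X : I → Set) → Set
Family I X = (i j : I) → F I X (X i ⊎ X j)

α : (I : Set) (X : I → Set) → Family I X → (Y : Set) → F I X Y → F I X Y → F I X Y
α I X s Y (i , a) (j , b) = Fmap I X [ a , b ] (s i j)

Commutative : (I : Set) (X : I → Set) → Family I X → Set₁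
Commutative I X s = (Y : Set) (a b : Y → F I X Y) (y : Y) →
  FEq I X (α I X s Y (a y) (b y)) (α I X s Y (b y) (a y))

swap⊎ : {A B : Set} → A ⊎ B → B ⊎ A
swap⊎ = [ inj₂ , inj₁ ]

module Submission where

-- By Yoneda, α^s is determined by its value on the generic pair
-- ((i, inj₁), (j, inj₂)) in F(X_i + X_j), which is s_ij; swapping the pair
-- yields F[i₂,i₁](s_ji).  So commutativity at these pairs is exactly the
-- condition, and conversely the condition transports along every copairing
-- [a, b] because [a, b] = [b, a] ∘ [i₂, i₁].  On the diagonal the condition
-- says that s_ii is fixed by the swap, which no element of X_i + X_i is.

open import Defs
open import Data.Product using (_×_; proj₁; _,_)
open import Data.Sum using (_⊎_; inj₁; inj₂; [_,_]′)
open import Data.Unit using (⊤; tt)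
open import Relation.Nullary using (¬_)
open import Function using (_∘_)
open import Function.Bundles using (_⇔_; mk⇔)
open import Relation.Binary.PropositionalEquality using (_≡_; _≢_; _≗_; refl; trans; cong; subst)

[,]≡[,]∘swap⊎ : {A B C : Set} (a : A → C) (b : B → C) (u : A ⊎ B) →
                [ a , b ]′ u ≡ [ b , a ]′ (swap⊎ u)
[,]≡[,]∘swap⊎ a b (inj₁ x) = refl
[,]≡[,]∘swap⊎ a b (inj₂ x) = refl

swap⊎-fixedPointFree : {A : Set} (u : A ⊎ A) → swap⊎ u ≢ u
swap⊎-fixedPointFree (inj₁ x) ()
swap⊎-fixedPointFree (inj₂ x) ()

module _ {I : Set} {X : I → Set} where

  FEq-Fmap-factor : {A B C : Set} {φ : A → B} {g : A → C} {h : B → C} →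
                    g ≗ h ∘ φ →
                    (t : F I X A) (t′ : F I X B) →
                    FEq I X (Fmap I X φ t) t′ → FEq I X (Fmap I X g t) (Fmap I X h t′)
  FEq-Fmap-factor {h = h} g≡h∘φ (k , f) (k′ , f′) (p , e) =
    p , λ x → trans (g≡h∘φ (f x)) (cong h (e x))

  FEq-Fmap-cancel : {A B C : Set} {φ : A → B} {g : A → C} {h : B → C} →
                    (∀ u v → g u ≡ h v → φ u ≡ v) →
                    (t : F I X A) (t′ : F I X B) →
                    FEq I X (Fmap I X g t) (Fmap I X h t′) → FEq I X (Fmap I X φ t) t′
  FEq-Fmap-cancel g≡h⇒φ≡ (k , f) (k′ , f′) (p , e) =
    p , λ x → g≡h⇒φ≡ (f x) (f′ (subst X p x)) (e x)

  FEq-Fmap-fixedPointFree : {A : Set} {φ : A → A} → (∀ u → φ u ≢ u) →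
                            (t : F I X A) → FEq I X (Fmap I X φ t) t → ¬ X (proj₁ t)
  FEq-Fmap-fixedPointFree φ-free (k , f) (refl , e) x = φ-free (f x) (e x)

module _ (I : Set) (X : I → Set) (s : Family I X) where

  SwapCompatible : Set
  SwapCompatible = (i j : I) → FEq I X (Fmap I X swap⊎ (s i j)) (s j i)

  SwapCompatible⇒Commutative : SwapCompatible → Commutative I X s
  SwapCompatible⇒Commutative compat Y a b y with a y | b y
  ... | i , a′ | j , b′ =
    FEq-Fmap-factor {φ = swap⊎} {g = [ a′ , b′ ]′} {h = [ b′ , a′ ]′}
      ([,]≡[,]∘swap⊎ a′ b′) (s i j) (s j i) (compat i j)

  -- The point tt only makes Y inhabited, so that commutativity can be evaluated.
  Commutative⇒SwapCompatible : Commutative I X s → SwapCompatible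
  Commutative⇒SwapCompatible comm i j =
    FEq-Fmap-cancel {φ = swap⊎} {g = [ ι₁ , ι₂ ]′} {h = [ ι₂ , ι₁ ]′}
      generic-swap (s i j) (s j i) (comm Y (λ _ → i , ι₁) (λ _ → j , ι₂) (inj₁ tt))
    where
      Y : Set
      Y = ⊤ ⊎ (X i ⊎ X j)

      ι₁ : X i → Y
      ι₁ = inj₂ ∘ inj₁

      ι₂ : X j → Y
      ι₂ = inj₂ ∘ inj₂

      generic-swap : (u : X i ⊎ X j) (v : X j ⊎ X i) →
                     [ ι₁ , ι₂ ]′ u ≡ [ ι₂ , ι₁ ]′ v → swap⊎ u ≡ v
      generic-swap (inj₁ x) (inj₂ .x) refl = refl
      generic-swap (inj₂ x) (inj₁ .x) refl = refl
      generic-swap (inj₁ x) (inj₁ y) ()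
      generic-swap (inj₂ x) (inj₂ y) ()

  SwapCompatible⇒diagonal-empty : SwapCompatible → (i : I) → ¬ X (proj₁ (s i i))
  SwapCompatible⇒diagonal-empty compat i =
    FEq-Fmap-fixedPointFree swap⊎-fixedPointFree (s i i) (compat i i)

proposition5p1 : (I : Set) (X : I → Set) → I → (s : Family I X) →
    (Commutative I X s ⇔ ((i j : I) → FEq I X (Fmap I X swap⊎ (s i j)) (s j i)))
    × (Commutative I X s → (i : I) → ¬ X (proj₁ (s i i)))
proposition5p1 I X _ s =
  mk⇔ (Commutative⇒SwapCompatible I X s) (SwapCompatible⇒Commutative I X s) ,
  SwapCompatible⇒diagonal-empty I X s ∘ Commutative⇒SwapCompatible I X s
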